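{- Let $H$ be the graph on $9$ vertices consisting of a triangle $\Delta_0$ on the vertices $0,1,2$ together with, for each $i\in\{0,1,2\}$, a triangle $\Delta_i^*$ on the vertices $i,p_i,q_i$, where $p_0,q_0,p_1,q_1,p_2,q_2$ are six new, pairwise distinct vertices. Let the 2-hive be the Cartesian product graph $\mathcal H=H\,\square\,H$ (81 vertices). Then there exists a non-isolated perfect dominating set $S\subseteq V(\mathcal H)$ of $\mathcal H$ whose induced subgraph $[S]$ has exactly six connected components: four isomorphic to $K_2$, one isomorphic to the $4$-cycle $K_2\square K_2$, and one isomorphic to the triangular prism $K_3\square K_2$.
   Context: A tersquare (ternary $2$-cube) is the graph $K_3\square K_3$. The 2-hive $\mathcal H=H\square H$ is exactly the union of the $16$ tersquares $\Delta\times\Delta'$ with $\Delta,\Delta'\in\{\Delta_0,\Delta_0^*,\Delta_1^*,\Delta_2^*\}$: the central tersquare $\Delta_0\times\Delta_0$, six subcentral tersquares (each sharing exactly one triangle with the central one), and nine corner tersquares $\Delta_i^*\times\Delta_j^*$ (each sharing exactly one vertex with the central one); it is an edge-disjoint union of triangles. For a graph $G$ that is an edge-disjoint union of triangles, a set $S\subseteq V(G)$ is a non-isolated perfect dominating set of $G$ if every vertex of $G$ not in $S$ is adjacent either to exactly one vertex of $S$, or to exactly the two end-vertices of an edge of the induced subgraph $[S]$ (and to no other vertex of $S$). $[S]$ denotes the subgraph of $G$ induced by $S$. -}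

module Defs where

open import Data.Nat using (ℕ)
open import Data.Fin using (Fin; zero; suc)
open import Data.Bool using (Bool; true; false; T)
open import Data.Product using (Σ; ∃; _×_; _,_; ∃-syntax)
open import Data.Sum using (_⊎_)
open import Relation.Binary.PropositionalEquality using (_≡_; _≢_)
open import Relation.Nullary using (¬_)
open import Relation.Binary.Construct.Closure.ReflexiveTransitive using (Star)
open import Function.Bundles using (_↔_; _⇔_; Inverse)

record Graph : Set₁ where
  field
    V : Set
    E : V → V → Set
open Graph public

_□_ : Graph → Graph → Graph
G □ G' = record
  { V = V G × V G'
  ; E = λ { (a , b) (c , d) → (a ≡ c × E G' b d) ⊎ (E G a c × b ≡ d) } }

K : ℕ → Graph
K n = record { V = Fin n ; E = λ x y → x ≢ y }

Induced : (G : Graph) → (V G → Set) → Graph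
Induced G P = record { V = Σ (V G) P ; E = λ x y → E G (Σ.proj₁ x) (Σ.proj₁ y) }

_≅_ : Graph → Graph → Set
G ≅ G' = Σ (V G ↔ V G') λ f →
  ∀ x y → E G x y ⇔ E G' (Inverse.to f x) (Inverse.to f y)

-- Vertex encoding (Fin 9):
--   0,1,2  = the central vertices 0,1,2
--   3+i    = p_i   (i = 0,1,2)
--   6+i    = q_i   (i = 0,1,2)
-- Triangles (Fin 4): 0 ↦ Δ₀ = {0,1,2};  suc i ↦ Δ_i^* = {i, p_i, q_i}.
inTri : Fin 4 → Fin 9 → Bool
inTri zero zero = true
inTri zero (suc zero) = true
inTri zero (suc (suc zero)) = true
inTri zero _ = false
inTri (suc zero) zero = true
inTri (suc zero) (suc (suc (suc zero))) = true
inTri (suc zero) (suc (suc (suc (suc (suc (suc zero)))))) = true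
inTri (suc zero) _ = false
inTri (suc (suc zero)) (suc zero) = true
inTri (suc (suc zero)) (suc (suc (suc (suc zero)))) = true
inTri (suc (suc zero)) (suc (suc (suc (suc (suc (suc (suc zero))))))) = true
inTri (suc (suc zero)) _ = false
inTri (suc (suc (suc zero))) (suc (suc zero)) = true
inTri (suc (suc (suc zero))) (suc (suc (suc (suc (suc zero))))) = true
inTri (suc (suc (suc zero))) (suc (suc (suc (suc (suc (suc (suc (suc zero)))))))) = true
inTri (suc (suc (suc zero))) _ = false

H : Graph
H = record { V = Fin 9 ; E = λ x y → x ≢ y × ∃[ t ] (T (inTri t x) × T (inTri t y)) }

Hive : Graph
Hive = H □ H

IsNIPDS : (G : Graph) → (V G → Bool) → Set
IsNIPDS G S = ∀ v → ¬ T (S v) →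
    (∃[ u ] (T (S u) × E G v u × (∀ w → T (S w) → E G v w → w ≡ u)))
  ⊎ (∃[ a ] ∃[ b ] (T (S a) × T (S b) × E G a b × E G v a × E G v b ×
       (∀ w → T (S w) → E G v w → (w ≡ a ⊎ w ≡ b))))

componentType : Fin 6 → Graph
componentType zero = K 2
componentType (suc zero) = K 2
componentType (suc (suc zero)) = K 2
componentType (suc (suc (suc zero))) = K 2
componentType (suc (suc (suc (suc zero)))) = K 2 □ K 2
componentType (suc (suc (suc (suc (suc zero))))) = K 3 □ K 2

-- A graph G has exactly n connected components, the k-th isomorphic to T k:
-- a labelling c of vertices by Fin n such that two vertices get the same label
-- iff they are joined by a path, and each label class induces a graph ≅ T k.
HasComponents : (G : Graph) (n : ℕ) → (Fin n → Graph) → Set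
HasComponents G n Ty = Σ (V G → Fin n) λ c →
    (∀ x y → (c x ≡ c y ⇔ Star (E G) x y))
  × (∀ k → Induced G (λ x → c x ≡ k) ≅ Ty k)

-- S is the union of six induced copies of the required component types, placed
-- (writing (x , y) for a vertex of H □ H and cᵢ for the central vertex i of H) as
--   {c₀} × {p₂, q₂},  {c₂} × {p₀, q₀},  {c₂} × {p₁, q₁},  {p₂, q₂} × {c₂}      (four K₂),
--   {p₀, q₀} × {c₀, c₁}  (a 4-cycle),   {p₁, q₁} × {c₀, c₁, c₂}  (a prism).
-- The copies are pairwise disjoint and joined by no edge, so [S] is their disjoint
-- union and its components are exactly the (connected) copies.  That the copies are
-- induced and disjoint, and that every vertex outside S sees exactly one vertex of S
-- or exactly the two ends of an edge of [S], are finite checks decided by computation.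
module Submission where

open import Defs
open import Data.Bool using (Bool; T)
open import Data.Bool.Properties using (T-irrelevant)
open import Data.Fin using (Fin; zero; suc; #_; _↑ˡ_; _↑ʳ_; inject₁)
open import Data.Fin.Properties as Finₚ using (any?)
open import Data.List using (List; []; _∷_; [_]; map; filter; concatMap; allFin; cartesianProduct)
open import Data.List.Membership.Propositional using (_∈_; lose)
open import Data.List.Membership.Propositional.Properties
  using (∈-allFin; ∈-map⁺; ∈-concatMap⁺; ∈-cartesianProduct⁺; ∈-filter⁺; ∈-filter⁻)
import Data.List.Relation.Unary.All as All
open import Data.List.Relation.Unary.Any as Any using (here; there)
open import Data.Product using (Σ; ∃; ∃-syntax; _×_; _,_; proj₁; proj₂)
open import Data.Product.Properties using (≡-dec)
open import Data.Product.Function.Dependent.Propositional using (Σ-↔)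
open import Data.Sum using (_⊎_; inj₁; inj₂)
open import Function using (_∘_)
open import Function.Bundles using (_⇔_; Inverse; Equivalence; mk↔ₛ′; mk⇔)
open import Function.Properties.Inverse using (↔-refl; ↔-trans)
open import Function.Construct.Composition using (_⇔-∘_)
open import Function.Construct.Symmetry using (⇔-sym)
open import Relation.Binary.Definitions using (Decidable; DecidableEquality)
open import Relation.Binary.PropositionalEquality using (_≡_; refl; sym; cong; subst₂)
open import Relation.Binary.Construct.Closure.ReflexiveTransitive using (Star; ε; _◅_; _◅◅_; gmap)
open import Relation.Nullary using (¬_; Dec; yes; no)
open import Relation.Nullary.Decidable
  using (⌊_⌋; map′; T?; ¬?; _×-dec_; _⊎-dec_; _→-dec_; toWitness; fromWitness; from-yes)

_⇔-dec_ : ∀ {A B : Set} → Dec A → Dec B → Dec (A ⇔ B)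
a? ⇔-dec b? = map′ (λ (to , from) → mk⇔ to from) (λ a⇔b → Equivalence.to a⇔b , Equivalence.from a⇔b)
                   ((a? →-dec b?) ×-dec (b? →-dec a?))

record Finite (G : Graph) : Set where
  field
    vertices : List (V G)
    ∈-vertices : ∀ x → x ∈ vertices
    _≟_ : DecidableEquality (V G)
    adjacent? : Decidable (E G)

  ∀? : {P : V G → Set} → (∀ x → Dec (P x)) → Dec (∀ x → P x)
  ∀? P? = map′ (λ ps x → All.lookup ps (∈-vertices x)) (λ ps → All.tabulate (λ {x} _ → ps x))
               (All.all? P? vertices)

  ∃? : {P : V G → Set} → (∀ x → Dec (P x)) → Dec (∃ P)
  ∃? P? = map′ Any.satisfied (λ (x , px) → lose (∈-vertices x) px) (Any.any? P? vertices)

open Finite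

K-finite : ∀ n → Finite (K n)
K-finite n = record
  { vertices = allFin n ; ∈-vertices = ∈-allFin ; _≟_ = Finₚ._≟_
  ; adjacent? = λ x y → ¬? (x Finₚ.≟ y) }

H-finite : Finite H
H-finite = record
  { vertices = allFin 9 ; ∈-vertices = ∈-allFin ; _≟_ = Finₚ._≟_
  ; adjacent? = λ x y → ¬? (x Finₚ.≟ y) ×-dec any? (λ t → T? (inTri t x) ×-dec T? (inTri t y)) }

□-finite : ∀ {G G′} → Finite G → Finite G′ → Finite (G □ G′)
□-finite {G} {G′} F F′ = record
  { vertices = cartesianProduct (vertices F) (vertices F′)
  ; ∈-vertices = λ (x , y) → ∈-cartesianProduct⁺ (∈-vertices F x) (∈-vertices F′ y)
  ; _≟_ = ≡-dec (_≟_ F) (_≟_ F′)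
  ; adjacent? = adjacent?′ }
  where
  adjacent?′ : Decidable (E (G □ G′))
  adjacent?′ (a , b) (c , d) =
    (_≟_ F a c ×-dec adjacent? F′ b d) ⊎-dec (adjacent? F a c ×-dec _≟_ F′ b d)

data ∐-Edge {n} (Ty : Fin n → Graph) : Σ (Fin n) (V ∘ Ty) → Σ (Fin n) (V ∘ Ty) → Set where
  within : ∀ {k x y} → E (Ty k) x y → ∐-Edge Ty (k , x) (k , y)

∐ : ∀ {n} → (Fin n → Graph) → Graph
∐ {n} Ty = record { V = Σ (Fin n) (V ∘ Ty) ; E = ∐-Edge Ty }

∐-finite : ∀ {n} {Ty : Fin n → Graph} → (∀ k → Finite (Ty k)) → Finite (∐ Ty)
∐-finite {n} {Ty} F = record
  { vertices = concatMap (λ k → map (k ,_) (vertices (F k))) (allFin n)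
  ; ∈-vertices = λ (k , x) → ∈-concatMap⁺ _ (lose (∈-allFin k) (∈-map⁺ (k ,_) (∈-vertices (F k) x)))
  ; _≟_ = ≡-dec Finₚ._≟_ (_≟_ (F _))
  ; adjacent? = adjacent?′ }
  where
  adjacent?′ : Decidable (∐-Edge Ty)
  adjacent?′ (k , x) (l , y) with k Finₚ.≟ l
  ... | yes refl = map′ within (λ { (within e) → e }) (adjacent? (F k) x y)
  ... | no k≢l = no λ { (within _) → k≢l refl }

Connected : Graph → Set
Connected G = ∀ x y → Star (E G) x y

K-connected : ∀ n → Connected (K n)
K-connected n x y with x Finₚ.≟ y
... | yes refl = ε
... | no x≢y = x≢y ◅ ε

□-connected : ∀ {G G′} → Connected G → Connected G′ → Connected (G □ G′)
□-connected conn conn′ (a , b) (c , d) =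
  gmap (_, b) (λ e → inj₂ (e , refl)) (conn a c) ◅◅ gmap (c ,_) (λ e → inj₁ (refl , e)) (conn′ b d)

module _ {n} (Ty : Fin n → Graph) where

  ∐-Star-label : ∀ {x y} → Star (∐-Edge Ty) x y → proj₁ x ≡ proj₁ y
  ∐-Star-label ε = refl
  ∐-Star-label (within _ ◅ p) = ∐-Star-label p

  ∐-component : ∀ k → Induced (∐ Ty) (λ x → proj₁ x ≡ k) ≅ Ty k
  ∐-component k = mk↔ₛ′ to from (λ _ → refl) (λ { ((_ , _) , refl) → refl }) , edges
    where
    to : Σ (V (∐ Ty)) (λ x → proj₁ x ≡ k) → V (Ty k)
    to ((_ , x) , refl) = x
    from : V (Ty k) → Σ (V (∐ Ty)) (λ x → proj₁ x ≡ k)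
    from x = (k , x) , refl
    edges : ∀ x y → ∐-Edge Ty (proj₁ x) (proj₁ y) ⇔ E (Ty k) (to x) (to y)
    edges ((_ , x) , refl) ((_ , y) , refl) = mk⇔ (λ { (within e) → e }) within

  ∐-hasComponents : (∀ k → Connected (Ty k)) → HasComponents (∐ Ty) n Ty
  ∐-hasComponents conn = proj₁ , (λ x y → mk⇔ (sameLabel-connected x y) ∐-Star-label) , ∐-component
    where
    sameLabel-connected : ∀ x y → proj₁ x ≡ proj₁ y → Star (∐-Edge Ty) x y
    sameLabel-connected (k , x) (_ , y) refl = gmap (k ,_) within (conn k x y)

≅-trans : ∀ {A B C} → A ≅ B → B ≅ C → A ≅ C
≅-trans (φ , φ-edges) (ψ , ψ-edges) =
  ↔-trans φ ψ , λ x y → ψ-edges (Inverse.to φ x) (Inverse.to φ y) ⇔-∘ φ-edges x y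

module _ {G G′ : Graph} (iso : G ≅ G′) where
  open Inverse (proj₁ iso)

  Star-≅ : ∀ {x y} → Star (E G) x y ⇔ Star (E G′) (to x) (to y)
  Star-≅ {x} {y} = mk⇔ (gmap to (λ {a} {b} → Equivalence.to (proj₂ iso a b))) backward
    where
    edge-back : ∀ {u v} → E G′ u v → E G (from u) (from v)
    edge-back {u} {v} e = Equivalence.from (proj₂ iso (from u) (from v))
      (subst₂ (E G′) (sym (strictlyInverseˡ u)) (sym (strictlyInverseˡ v)) e)
    backward : Star (E G′) (to x) (to y) → Star (E G) x y
    backward p = subst₂ (Star (E G)) (strictlyInverseʳ x) (strictlyInverseʳ y) (gmap from edge-back p)

  Induced-≅ : (P : V G′ → Set) → Induced G (P ∘ to) ≅ Induced G′ P
  Induced-≅ P = Σ-↔ (proj₁ iso) ↔-refl , λ x y → proj₂ iso (proj₁ x) (proj₁ y)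

  hasComponents-≅ : ∀ {n} {Ty : Fin n → Graph} → HasComponents G′ n Ty → HasComponents G n Ty
  hasComponents-≅ {Ty = Ty} (label , conn , components) =
    label ∘ to ,
    (λ x y → ⇔-sym Star-≅ ⇔-∘ conn (to x) (to y)) ,
    (λ k → ≅-trans {C = Ty k} (Induced-≅ (λ y → label y ≡ k)) (components k))

module _ {G G′ : Graph} (G′-finite : Finite G′) (_≟ᴳ_ : DecidableEquality (V G)) (f : V G′ → V G) where

  inImage? : ∀ v → Dec (∃ λ x → f x ≡ v)
  inImage? v = ∃? G′-finite (λ x → f x ≟ᴳ v)

  inImage : V G → Bool
  inImage v = ⌊ inImage? v ⌋

  image-≅ : (∀ x y → f x ≡ f y → x ≡ y) → (∀ x y → E G′ x y ⇔ E G (f x) (f y)) →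
            Induced G (λ v → T (inImage v)) ≅ G′
  image-≅ injective induced = mk↔ₛ′ to from to∘from from∘to , edges
    where
    preimage : ∀ {v} → T (inImage v) → ∃ λ x → f x ≡ v
    preimage {v} = toWitness {a? = inImage? v}
    to : Σ (V G) (T ∘ inImage) → V G′
    to (_ , p) = proj₁ (preimage p)
    from : V G′ → Σ (V G) (T ∘ inImage)
    from x = f x , fromWitness (x , refl)
    to∘from : ∀ x → to (from x) ≡ x
    to∘from x = injective _ _ (proj₂ (preimage (proj₂ (from x))))
    from∘to : ∀ v → from (to v) ≡ v
    from∘to (v , p) with preimage p
    ... | x , refl = cong (f x ,_) (T-irrelevant _ p)
    edges : ∀ v w → E G (proj₁ v) (proj₁ w) ⇔ E G′ (to v) (to w)
    edges (v , p) (w , q) with preimage p | preimage q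
    ... | x , refl | y , refl = ⇔-sym (induced x y)

data PerfectNeighbourhood (G : Graph) : List (V G) → Set where
  single : ∀ u → PerfectNeighbourhood G [ u ]
  edge   : ∀ {a b} → E G a b → PerfectNeighbourhood G (a ∷ b ∷ [])

perfectNeighbourhood? : ∀ {G} → Decidable (E G) → ∀ us → Dec (PerfectNeighbourhood G us)
perfectNeighbourhood? adjacent? []              = no λ ()
perfectNeighbourhood? adjacent? (u ∷ [])        = yes (single u)
perfectNeighbourhood? adjacent? (a ∷ b ∷ [])    = map′ edge (λ { (edge e) → e }) (adjacent? a b)
perfectNeighbourhood? adjacent? (_ ∷ _ ∷ _ ∷ _) = no λ ()

-- IsNIPDS G S unfolds to  ∀ v → ¬ T (S v) → PerfectlyDominated G S v.
PerfectlyDominated : (G : Graph) → (V G → Bool) → V G → Set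
PerfectlyDominated G S v =
    (∃[ u ] (T (S u) × E G v u × (∀ w → T (S w) → E G v w → w ≡ u)))
  ⊎ (∃[ a ] ∃[ b ] (T (S a) × T (S b) × E G a b × E G v a × E G v b ×
       (∀ w → T (S w) → E G v w → (w ≡ a ⊎ w ≡ b))))

module _ {G : Graph} (G-finite : Finite G) (S : V G → Bool) where

  dominator? : ∀ v w → Dec (E G v w × T (S w))
  dominator? v w = adjacent? G-finite v w ×-dec T? (S w)

  dominators : V G → List (V G)
  dominators v = filter (dominator? v) (vertices G-finite)

  perfectlyDominated : ∀ {v us} → (∀ {w} → w ∈ us ⇔ (E G v w × T (S w))) →
                       PerfectNeighbourhood G us → PerfectlyDominated G S v
  perfectlyDominated ∈us (single u) with Equivalence.to ∈us (here refl)
  ... | v~u , u∈S = inj₁ (u , u∈S , v~u , λ w w∈S v~w → only (Equivalence.from ∈us (v~w , w∈S)))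
    where
    only : ∀ {w} → w ∈ [ u ] → w ≡ u
    only (here w≡u) = w≡u
  perfectlyDominated ∈us (edge {a} {b} a~b)
    with Equivalence.to ∈us (here refl) | Equivalence.to ∈us (there (here refl))
  ... | v~a , a∈S | v~b , b∈S =
    inj₂ (a , b , a∈S , b∈S , a~b , v~a , v~b , λ w w∈S v~w → oneOf (Equivalence.from ∈us (v~w , w∈S)))
    where
    oneOf : ∀ {w} → w ∈ a ∷ b ∷ [] → w ≡ a ⊎ w ≡ b
    oneOf (here w≡a) = inj₁ w≡a
    oneOf (there (here w≡b)) = inj₂ w≡b

  isNIPDS : (∀ v → ¬ T (S v) → PerfectNeighbourhood G (dominators v)) → IsNIPDS G S
  isNIPDS perfect v v∉S = perfectlyDominated ∈dominators (perfect v v∉S)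
    where
    ∈dominators : ∀ {w} → w ∈ dominators v ⇔ (E G v w × T (S w))
    ∈dominators {w} = mk⇔ (proj₂ ∘ ∈-filter⁻ (dominator? v) {xs = vertices G-finite})
                          (∈-filter⁺ (dominator? v) (∈-vertices G-finite w))

Hive-finite : Finite Hive
Hive-finite = □-finite H-finite H-finite

componentType-finite : ∀ k → Finite (componentType k)
componentType-finite zero                                = K-finite 2
componentType-finite (suc zero)                          = K-finite 2
componentType-finite (suc (suc zero))                    = K-finite 2
componentType-finite (suc (suc (suc zero)))              = K-finite 2
componentType-finite (suc (suc (suc (suc zero))))        = □-finite (K-finite 2) (K-finite 2)
componentType-finite (suc (suc (suc (suc (suc zero))))) = □-finite (K-finite 3) (K-finite 2)

componentType-connected : ∀ k → Connected (componentType k)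
componentType-connected zero                                = K-connected 2
componentType-connected (suc zero)                          = K-connected 2
componentType-connected (suc (suc zero))                    = K-connected 2
componentType-connected (suc (suc (suc zero)))              = K-connected 2
componentType-connected (suc (suc (suc (suc zero))))        = □-connected (K-connected 2) (K-connected 2)
componentType-connected (suc (suc (suc (suc (suc zero))))) = □-connected (K-connected 3) (K-connected 2)

copies-domain-finite : Finite (∐ componentType)
copies-domain-finite = ∐-finite componentType-finite

centre : Fin 3 → Fin 9
centre i = i ↑ˡ 6

-- outer i 0 = pᵢ and outer i 1 = qᵢ.
outer : Fin 3 → Fin 2 → Fin 9
outer i zero       = 3 ↑ʳ (i ↑ˡ 3)
outer i (suc zero) = 6 ↑ʳ i

copies : V (∐ componentType) → V Hive
copies (zero , t)                                   = centre (# 0) , outer (# 2) t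
copies (suc zero , t)                               = centre (# 2) , outer (# 0) t
copies (suc (suc zero) , t)                         = centre (# 2) , outer (# 1) t
copies (suc (suc (suc zero)) , t)                   = outer (# 2) t , centre (# 2)
copies (suc (suc (suc (suc zero))) , (i , j))       = outer (# 0) i , centre (inject₁ j)
copies (suc (suc (suc (suc (suc zero)))) , (i , j)) = outer (# 1) j , centre i

copies-injective : ∀ x y → copies x ≡ copies y → x ≡ y
copies-injective = from-yes (∀? copies-domain-finite λ x → ∀? copies-domain-finite λ y →
  _≟_ Hive-finite (copies x) (copies y) →-dec _≟_ copies-domain-finite x y)

copies-induced : ∀ x y → E (∐ componentType) x y ⇔ E Hive (copies x) (copies y)
copies-induced = from-yes (∀? copies-domain-finite λ x → ∀? copies-domain-finite λ y →
  adjacent? copies-domain-finite x y ⇔-dec adjacent? Hive-finite (copies x) (copies y))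

S : V Hive → Bool
S = inImage {G = Hive} copies-domain-finite (_≟_ Hive-finite) copies

S-isNIPDS : IsNIPDS Hive S
S-isNIPDS = isNIPDS Hive-finite S (from-yes (∀? Hive-finite λ v →
  ¬? (T? (S v)) →-dec perfectNeighbourhood? (adjacent? Hive-finite) (dominators Hive-finite S v)))

S-≅ : Induced Hive (λ v → T (S v)) ≅ ∐ componentType
S-≅ = image-≅ {G = Hive} copies-domain-finite (_≟_ Hive-finite) copies copies-injective copies-induced

S-hasComponents : HasComponents (Induced Hive (λ v → T (S v))) 6 componentType
S-hasComponents =
  hasComponents-≅ S-≅ {Ty = componentType} (∐-hasComponents componentType componentType-connected)

theorem5 : Σ (V Hive → Bool) λ S → IsNIPDS Hive S × HasComponents (Induced Hive (λ v → T (S v))) 6 componentType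
theorem5 = S , S-isNIPDS , S-hasComponents
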